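{- For $n\ge1$ and $k\ge0$ let $c(n,k)$ be the number of Catalan words of length $n$ avoiding the pattern $(\geq,\geq)$ whose last letter is $k$ (so $c(n,k)=0$ for $k\ge n$). Then $c(1,0)=c(2,0)=c(2,1)=1$, and for all $n\ge2$ and $0\le k\le n-1$, \begin{align*} c(n+1, 0)&=c(n-1, 0)+c(n-1,1)+\cdots +c(n-1, n-2),\\ c(n+1, k+1)&=c(n, k)+c(n-1, k)+c(n-1,k+1)+\cdots +c(n-1, n-2), \end{align*} where a sum $c(n-1,k)+\cdots+c(n-1,n-2)$ with $k>n-2$ is empty.
   Context: A Catalan word of length $n\ge 0$ is a sequence $w=w_1\cdots w_n$ of non-negative integers with $w_1=0$ and $0\le w_i\le w_{i-1}+1$ for $i=2,\dots,n$. It avoids the pattern $(\geq,\geq)$ if there is no index $i$ with $w_i\ge w_{i+1}\ge w_{i+2}$. -}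

module Defs where

open import Data.Nat using (ℕ; zero; suc; _+_; _∸_; _≤_; _≥_; _≟_; _≤?_)
open import Data.List using (List; []; _∷_; length; map; concatMap; filter; applyUpTo; upTo; last)
open import Data.Nat.ListAction using (sum)
open import Data.Maybe using (Maybe; just; nothing)
open import Data.Product using (_×_; _,_)
open import Data.Empty using (⊥)
open import Data.Unit using (⊤)
open import Relation.Nullary using (¬_; Dec; yes; no)
open import Relation.Nullary.Decidable using (_×-dec_; ¬?)
open import Relation.Binary.PropositionalEquality using (_≡_)

Steps : List ℕ → Set
Steps []           = ⊤
Steps (a ∷ [])     = ⊤
Steps (a ∷ b ∷ w)  = (b ≤ suc a) × Steps (b ∷ w)

IsCatalan : List ℕ → Set
IsCatalan []       = ⊤
IsCatalan (a ∷ w)  = (a ≡ 0) × Steps (a ∷ w)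

Avoids : List ℕ → Set
Avoids (a ∷ b ∷ c ∷ w) = ¬ (a ≥ b × b ≥ c) × Avoids (b ∷ c ∷ w)
Avoids _               = ⊤

LastIs : ℕ → List ℕ → Set
LastIs k w = last w ≡ just k

steps? : (w : List ℕ) → Dec (Steps w)
steps? []          = yes _
steps? (a ∷ [])    = yes _
steps? (a ∷ b ∷ w) = (b ≤? suc a) ×-dec steps? (b ∷ w)

catalan? : (w : List ℕ) → Dec (IsCatalan w)
catalan? []      = yes _
catalan? (a ∷ w) = (a ≟ 0) ×-dec steps? (a ∷ w)

avoids? : (w : List ℕ) → Dec (Avoids w)
avoids? (a ∷ b ∷ c ∷ w) = ¬? ((b ≤? a) ×-dec (c ≤? b)) ×-dec avoids? (b ∷ c ∷ w)
avoids? []              = yes _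
avoids? (a ∷ [])        = yes _
avoids? (a ∷ b ∷ [])    = yes _

lastIs? : (k : ℕ) (w : List ℕ) → Dec (LastIs k w)
lastIs? k w with last w
... | nothing = no λ ()
... | just x with x ≟ k
...   | yes Relation.Binary.PropositionalEquality.refl = yes Relation.Binary.PropositionalEquality.refl
...   | no x≢k = no λ { Relation.Binary.PropositionalEquality.refl → x≢k Relation.Binary.PropositionalEquality.refl }

words : ℕ → ℕ → List (List ℕ)
words b zero      = [] ∷ []
words b (suc len) = concatMap (λ x → map (x ∷_) (words b len)) (upTo b)

-- Every Catalan word of length n has all letters ≤ n - 1 < n, so the
-- Catalan words of length n are exactly those in (words n n) satisfying IsCatalan.
-- c n k = number of Catalan words of length n avoiding (≥,≥) with last letter k.
c : ℕ → ℕ → ℕ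
c n k = length (filter (λ w → (catalan? w ×-dec avoids? w) ×-dec lastIs? k w) (words n n))

-- sumFrom f a b = f a + f (a+1) + ⋯ + f b   (empty, i.e. 0, when a > b)
sumFrom : (ℕ → ℕ) → ℕ → ℕ → ℕ
sumFrom f a b = sum (applyUpTo (λ i → f (a + i)) (suc b ∸ a))

{-# OPTIONS --safe #-}
module Submission where

-- Call a word admissible if it is Catalan and avoids (≥,≥), and write a word of length
-- n + 1 ≥ 3 as t j i z. Being Catalan at the end means i ≤ j + 1 and z ≤ i + 1, and
-- avoiding (≥,≥) at the end means ¬ (j ≥ i ≥ z). If z ≤ i (forced when z = 0, as i = 0
-- would give j ≥ 0 ≥ 0), these leave only i = j + 1, and t j (j+1) z is admissible iff
-- t j is, because an ascent by one never creates the pattern. Otherwise z = i + 1 and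
-- t j i (i+1) is admissible iff t j i is. Summing over i gives both recurrences, once all
-- counts are written as sums of indicators over the words on one common alphabet.

open import Defs
open import Data.Bool using (true; false; if_then_else_)
open import Data.List
  using (List; []; _∷_; _++_; _∷ʳ_; length; map; concatMap; filter; applyUpTo; upTo; last)
open import Data.List.Properties using (map-++; map-cong; map-∘; map-upTo; length-++)
open import Data.List.Relation.Unary.All as All using (All; []; _∷_)
open import Data.List.Relation.Unary.All.Properties using (∷ʳ⁻)
open import Data.Maybe using (just)
open import Data.Maybe.Properties using (just-injective)
open import Data.Nat
  using (ℕ; zero; suc; _+_; _∸_; _≤_; _<_; _≥_; z≤n; s≤s; z<s; s<s; _≤′_; ≤′-refl; ≤′-step)
open import Data.Nat.Properties
open import Data.Nat.ListAction using (sum)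
open import Data.Nat.ListAction.Properties using (sum-++)
open import Data.Product using (_×_; _,_; proj₁; proj₂)
open import Data.Product.Function.NonDependent.Propositional using (_×-⇔_)
open import Data.Unit using (tt)
open import Function using (_∘_)
open import Function.Bundles using (_⇔_; mk⇔; Equivalence)
open import Function.Construct.Composition using (_⇔-∘_)
open import Function.Construct.Identity using (⇔-id)
open import Relation.Nullary using (¬_; Dec; does)
open import Relation.Nullary.Decidable using (_×-dec_; dec-false; does-⇔)
open import Relation.Unary using (Decidable)
open import Relation.Binary.PropositionalEquality
open import Algebra.Properties.CommutativeSemigroup +-commutativeSemigroup using (interchange)

open ≡-Reasoning

𝟙 : {A : Set} → Dec A → ℕ
𝟙 a? = if does a? then 1 else 0

𝟙-no : {A : Set} (a? : Dec A) → ¬ A → 𝟙 a? ≡ 0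
𝟙-no a? ¬a rewrite dec-false a? ¬a = refl

𝟙-⇔ : {A B : Set} (a? : Dec A) (b? : Dec B) → A ⇔ B → 𝟙 a? ≡ 𝟙 b?
𝟙-⇔ a? b? A⇔B = cong (λ t → if t then 1 else 0) (does-⇔ A⇔B a? b?)

length-filter≡sum-𝟙 : {A : Set} {P : A → Set} (P? : Decidable P) (xs : List A) →
  length (filter P? xs) ≡ sum (map (𝟙 ∘ P?) xs)
length-filter≡sum-𝟙 P? []       = refl
length-filter≡sum-𝟙 P? (x ∷ xs) with does (P? x)
... | true  = cong suc (length-filter≡sum-𝟙 P? xs)
... | false = length-filter≡sum-𝟙 P? xs

sum-map-concatMap : {A B : Set} (f : B → ℕ) (g : A → List B) (xs : List A) →
  sum (map f (concatMap g xs)) ≡ sum (map (λ x → sum (map f (g x))) xs)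
sum-map-concatMap f g []       = refl
sum-map-concatMap f g (x ∷ xs) = begin
  sum (map f (g x ++ concatMap g xs))              ≡⟨ cong sum (map-++ f (g x) _) ⟩
  sum (map f (g x) ++ map f (concatMap g xs))      ≡⟨ sum-++ (map f (g x)) _ ⟩
  sum (map f (g x)) + sum (map f (concatMap g xs)) ≡⟨ cong (_ +_) (sum-map-concatMap f g xs) ⟩
  sum (map f (g x)) + sum (map (λ y → sum (map f (g y))) xs) ∎

last-∷ʳ : {A : Set} (xs : List A) (x : A) → last (xs ∷ʳ x) ≡ just x
last-∷ʳ []           x = refl
last-∷ʳ (y ∷ [])     x = refl
last-∷ʳ (y ∷ z ∷ xs) x = last-∷ʳ (z ∷ xs) x

sumUpTo : (ℕ → ℕ) → ℕ → ℕ
sumUpTo f n = sum (applyUpTo f n)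

sumUpTo-cong : ∀ n {f g : ℕ → ℕ} → (∀ i → i < n → f i ≡ g i) → sumUpTo f n ≡ sumUpTo g n
sumUpTo-cong zero    f≡g = refl
sumUpTo-cong (suc n) f≡g = cong₂ _+_ (f≡g 0 z<s) (sumUpTo-cong n (λ i i<n → f≡g (suc i) (s<s i<n)))

sumUpTo-zero : ∀ n {f : ℕ → ℕ} → (∀ i → i < n → f i ≡ 0) → sumUpTo f n ≡ 0
sumUpTo-zero zero    f≡0 = refl
sumUpTo-zero (suc n) f≡0 = cong₂ _+_ (f≡0 0 z<s) (sumUpTo-zero n (λ i i<n → f≡0 (suc i) (s<s i<n)))

sumUpTo-+ : ∀ n (f g : ℕ → ℕ) → sumUpTo (λ i → f i + g i) n ≡ sumUpTo f n + sumUpTo g n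
sumUpTo-+ zero    f g = refl
sumUpTo-+ (suc n) f g =
  trans (cong (f 0 + g 0 +_) (sumUpTo-+ n (f ∘ suc) (g ∘ suc))) (interchange (f 0) (g 0) _ _)

sumUpTo-swap : ∀ m n (f : ℕ → ℕ → ℕ) →
  sumUpTo (λ i → sumUpTo (f i) n) m ≡ sumUpTo (λ j → sumUpTo (λ i → f i j) m) n
sumUpTo-swap zero    n f = sym (sumUpTo-zero n (λ _ _ → refl))
sumUpTo-swap (suc m) n f =
  trans (cong (sumUpTo (f 0) n +_) (sumUpTo-swap m n (f ∘ suc)))
        (sym (sumUpTo-+ n (f 0) (λ j → sumUpTo (λ i → f (suc i) j) m)))

sumUpTo-suc : ∀ n (f : ℕ → ℕ) → sumUpTo f (suc n) ≡ sumUpTo f n + f n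
sumUpTo-suc zero    f = +-comm (f 0) 0
sumUpTo-suc (suc n) f = trans (cong (f 0 +_) (sumUpTo-suc n (f ∘ suc))) (sym (+-assoc (f 0) _ _))

sumUpTo-trunc : ∀ {m n} (f : ℕ → ℕ) → m ≤ n → (∀ i → m ≤ i → f i ≡ 0) → sumUpTo f n ≡ sumUpTo f m
sumUpTo-trunc {m} f m≤n f≡0 = go (≤⇒≤′ m≤n)
  where
  go : ∀ {n} → m ≤′ n → sumUpTo f n ≡ sumUpTo f m
  go ≤′-refl            = refl
  go (≤′-step {n} m≤′n) = begin
    sumUpTo f (suc n)   ≡⟨ sumUpTo-suc n f ⟩
    sumUpTo f n + f n   ≡⟨ cong₂ _+_ (go m≤′n) (f≡0 n (≤′⇒≤ m≤′n)) ⟩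
    sumUpTo f m + 0     ≡⟨ +-identityʳ _ ⟩
    sumUpTo f m         ∎

sumUpTo-split : ∀ k m (f : ℕ → ℕ) →
  sumUpTo f (k + suc m) ≡ sumUpTo f k + f k + sumUpTo (λ i → f (suc (k + i))) m
sumUpTo-split zero    m f = refl
sumUpTo-split (suc k) m f = begin
  f 0 + sumUpTo (f ∘ suc) (k + suc m)       ≡⟨ cong (f 0 +_) (sumUpTo-split k m (f ∘ suc)) ⟩
  f 0 + (sumUpTo (f ∘ suc) k + f (suc k) + r) ≡⟨ sym (+-assoc (f 0) _ r) ⟩
  f 0 + (sumUpTo (f ∘ suc) k + f (suc k)) + r ≡⟨ cong (_+ r) (sym (+-assoc (f 0) _ _)) ⟩
  f 0 + sumUpTo (f ∘ suc) k + f (suc k) + r   ∎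
  where r = sumUpTo (λ i → f (suc (suc (k + i)))) m

sumUpTo-single : ∀ n k (f : ℕ → ℕ) → k < n → (∀ i → i < n → i ≢ k → f i ≡ 0) → sumUpTo f n ≡ f k
sumUpTo-single (suc n) zero    f _ f≡0 =
  trans (cong (f 0 +_) (sumUpTo-zero n λ i i<n → f≡0 (suc i) (s<s i<n) (λ ()))) (+-identityʳ (f 0))
sumUpTo-single (suc n) (suc k) f (s<s k<n) f≡0 =
  cong₂ _+_ (f≡0 0 z<s (λ ())) (sumUpTo-single n k (f ∘ suc) k<n λ i i<n i≢k →
    f≡0 (suc i) (s<s i<n) (i≢k ∘ suc-injective))

sumWords : ℕ → ℕ → (List ℕ → ℕ) → ℕ
sumWords b zero    f = f []
sumWords b (suc l) f = sumUpTo (λ x → sumWords b l (f ∘ (x ∷_))) b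

sum-map-words : ∀ b l (f : List ℕ → ℕ) → sum (map f (words b l)) ≡ sumWords b l f
sum-map-words b zero    f = +-identityʳ (f [])
sum-map-words b (suc l) f = begin
    sum (map f (concatMap (λ x → map (x ∷_) (words b l)) (upTo b)))
  ≡⟨ sum-map-concatMap f _ (upTo b) ⟩
    sum (map (λ x → sum (map f (map (x ∷_) (words b l)))) (upTo b))
  ≡⟨ cong sum (map-cong prefix (upTo b)) ⟩
    sum (map (λ x → sumWords b l (f ∘ (x ∷_))) (upTo b))
  ≡⟨ cong sum (map-upTo _ b) ⟩
    sumWords b (suc l) f ∎
  where
  prefix : ∀ x → sum (map f (map (x ∷_) (words b l))) ≡ sumWords b l (f ∘ (x ∷_))
  prefix x = trans (cong sum (sym (map-∘ (words b l)))) (sum-map-words b l (f ∘ (x ∷_)))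

sumWords-cong : ∀ b l {f g : List ℕ → ℕ} → f ≗ g → sumWords b l f ≡ sumWords b l g
sumWords-cong b zero    f≗g = f≗g []
sumWords-cong b (suc l) f≗g = sumUpTo-cong b (λ x _ → sumWords-cong b l (f≗g ∘ (x ∷_)))

sumWords-zero : ∀ b l {f : List ℕ → ℕ} → (∀ w → length w ≡ l → f w ≡ 0) → sumWords b l f ≡ 0
sumWords-zero b zero    f≡0 = f≡0 [] refl
sumWords-zero b (suc l) f≡0 =
  sumUpTo-zero b (λ x _ → sumWords-zero b l (λ w ∣w∣≡l → f≡0 (x ∷ w) (cong suc ∣w∣≡l)))

sumWords-∷ʳ : ∀ b l (f : List ℕ → ℕ) →
  sumWords b (suc l) f ≡ sumUpTo (λ x → sumWords b l (λ w → f (w ∷ʳ x))) b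
sumWords-∷ʳ b zero    f = refl
sumWords-∷ʳ b (suc l) f =
  trans (sumUpTo-cong b (λ y _ → sumWords-∷ʳ b l (f ∘ (y ∷_))))
        (sumUpTo-swap b b (λ y x → sumWords b l (λ w → f (y ∷ w ∷ʳ x))))

sumWords-restrict : ∀ {a b} l (f : List ℕ → ℕ) → a ≤ b →
  (∀ w → length w ≡ l → ¬ All (_< a) w → f w ≡ 0) → sumWords b l f ≡ sumWords a l f
sumWords-restrict         zero    f a≤b f≡0 = refl
sumWords-restrict {a} {b} (suc l) f a≤b f≡0 = begin
    sumUpTo (λ x → sumWords b l (f ∘ (x ∷_))) b
  ≡⟨ sumUpTo-trunc _ a≤b (λ x a≤x → sumWords-zero b l (λ w ∣w∣≡l →
       f≡0 (x ∷ w) (cong suc ∣w∣≡l) (λ { (x<a ∷ _) → <⇒≱ x<a a≤x }))) ⟩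
    sumUpTo (λ x → sumWords b l (f ∘ (x ∷_))) a
  ≡⟨ sumUpTo-cong a (λ x _ → sumWords-restrict l (f ∘ (x ∷_)) a≤b (λ w ∣w∣≡l ¬w<a →
       f≡0 (x ∷ w) (cong suc ∣w∣≡l) (¬w<a ∘ All.tail))) ⟩
    sumWords a (suc l) f ∎

×-prepend-⇔ : {S P Q R : Set} → P ⇔ (Q × R) → (S × P) ⇔ ((S × Q) × R)
×-prepend-⇔ P⇔Q×R = mk⇔
  (λ (s , p) → let (q , r) = to p in (s , q) , r)
  (λ ((s , q) , r) → s , from (q , r))
  where open Equivalence P⇔Q×R

Steps-∷ʳ : ∀ w a b → Steps (w ∷ʳ a ∷ʳ b) ⇔ (Steps (w ∷ʳ a) × b ≤ suc a)
Steps-∷ʳ []          a b = mk⇔ (λ (b≤1+a , _) → _ , b≤1+a) (λ (_ , b≤1+a) → b≤1+a , _)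
Steps-∷ʳ (x ∷ [])    a b = ×-prepend-⇔ (Steps-∷ʳ [] a b)
Steps-∷ʳ (x ∷ y ∷ w) a b = ×-prepend-⇔ (Steps-∷ʳ (y ∷ w) a b)

IsCatalan-∷ʳ : ∀ w a b → IsCatalan (w ∷ʳ a ∷ʳ b) ⇔ (IsCatalan (w ∷ʳ a) × b ≤ suc a)
IsCatalan-∷ʳ []      a b = ×-prepend-⇔ (Steps-∷ʳ [] a b)
IsCatalan-∷ʳ (x ∷ w) a b = ×-prepend-⇔ (Steps-∷ʳ (x ∷ w) a b)

Avoids-∷ʳ : ∀ w a b c → Avoids (w ∷ʳ a ∷ʳ b ∷ʳ c) ⇔ (Avoids (w ∷ʳ a ∷ʳ b) × ¬ (a ≥ b × b ≥ c))
Avoids-∷ʳ []              a b c = mk⇔ (λ (ok , _) → _ , ok) (λ (_ , ok) → ok , _)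
Avoids-∷ʳ (x ∷ [])        a b c = ×-prepend-⇔ (Avoids-∷ʳ [] a b c)
Avoids-∷ʳ (x ∷ y ∷ [])    a b c = ×-prepend-⇔ (Avoids-∷ʳ (y ∷ []) a b c)
Avoids-∷ʳ (x ∷ y ∷ z ∷ w) a b c = ×-prepend-⇔ (Avoids-∷ʳ (y ∷ z ∷ w) a b c)

Avoids-ascent : ∀ w {a b} → a < b → Avoids (w ∷ʳ a ∷ʳ b) ⇔ Avoids (w ∷ʳ a)
Avoids-ascent []              a<b = mk⇔ (λ _ → tt) (λ _ → tt)
Avoids-ascent (x ∷ [])        a<b = mk⇔ (λ _ → tt) (λ _ → (λ (_ , b≤a) → <⇒≱ a<b b≤a) , tt)
Avoids-ascent (x ∷ y ∷ [])    a<b = ⇔-id _ ×-⇔ Avoids-ascent (y ∷ []) a<b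
Avoids-ascent (x ∷ y ∷ z ∷ w) a<b = ⇔-id _ ×-⇔ Avoids-ascent (y ∷ z ∷ w) a<b

Steps-bounded : ∀ a w → Steps (a ∷ w) → All (_≤ a + length w) (a ∷ w)
Steps-bounded a []      _               = m≤m+n a 0 ∷ []
Steps-bounded a (b ∷ w) (b≤1+a , steps) =
  m≤m+n a _ ∷ All.map (λ x≤ → ≤-trans x≤ b+∣w∣≤a+∣bw∣) (Steps-bounded b w steps)
  where
  b+∣w∣≤a+∣bw∣ : b + length w ≤ a + suc (length w)
  b+∣w∣≤a+∣bw∣ = ≤-trans (+-monoˡ-≤ (length w) b≤1+a) (≤-reflexive (sym (+-suc a (length w))))

IsCatalan-bounded : ∀ w → IsCatalan w → All (_< length w) w
IsCatalan-bounded []      _            = []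
IsCatalan-bounded (a ∷ w) (refl , steps) = All.map s≤s (Steps-bounded 0 w steps)

IsCatalan-last≤length : ∀ t z → IsCatalan (t ∷ʳ z) → z ≤ length t
IsCatalan-last≤length t z cat =
  m<1+n⇒m≤n (subst (z <_) ∣tz∣≡1+∣t∣ (proj₂ (∷ʳ⁻ (IsCatalan-bounded (t ∷ʳ z) cat))))
  where
  ∣tz∣≡1+∣t∣ : length (t ∷ʳ z) ≡ suc (length t)
  ∣tz∣≡1+∣t∣ = trans (length-++ t) (+-comm _ 1)

CatalanAvoiding : List ℕ → Set
CatalanAvoiding w = IsCatalan w × Avoids w

catalanAvoiding? : (w : List ℕ) → Dec (CatalanAvoiding w)
catalanAvoiding? w = catalan? w ×-dec avoids? w

CatalanAvoiding-∷ʳ : ∀ w a b c → CatalanAvoiding (w ∷ʳ a ∷ʳ b ∷ʳ c) ⇔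
  (CatalanAvoiding (w ∷ʳ a ∷ʳ b) × c ≤ suc b × ¬ (a ≥ b × b ≥ c))
CatalanAvoiding-∷ʳ w a b c = mk⇔
  (λ (cat , av) → let (cat′ , c≤1+b) = I.to cat; (av′ , ok) = A.to av in (cat′ , av′) , c≤1+b , ok)
  (λ ((cat′ , av′) , c≤1+b , ok) → I.from (cat′ , c≤1+b) , A.from (av′ , ok))
  where
  module I = Equivalence (IsCatalan-∷ʳ (w ∷ʳ a) b c)
  module A = Equivalence (Avoids-∷ʳ w a b c)

CatalanAvoiding-ascent : ∀ w a → CatalanAvoiding (w ∷ʳ a ∷ʳ suc a) ⇔ CatalanAvoiding (w ∷ʳ a)
CatalanAvoiding-ascent w a = mk⇔
  (λ (cat , av) → proj₁ (I.to cat) , A.to av)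
  (λ (cat , av) → I.from (cat , ≤-refl) , A.from av)
  where
  module I = Equivalence (IsCatalan-∷ʳ w a (suc a))
  module A = Equivalence (Avoids-ascent w (n<1+n a))

CatalanAvoiding-∷ʳ-after-ascent : ∀ w {a b} c → a < b → c ≤ suc b →
  CatalanAvoiding (w ∷ʳ a ∷ʳ b ∷ʳ c) ⇔ CatalanAvoiding (w ∷ʳ a ∷ʳ b)
CatalanAvoiding-∷ʳ-after-ascent w {a} {b} c a<b c≤1+b =
  mk⇔ (proj₁ ∘ to) (λ ca → from (ca , c≤1+b , λ (b≤a , _) → <⇒≱ a<b b≤a))
  where open Equivalence (CatalanAvoiding-∷ʳ w a b c)

CatalanAvoiding-descent-pred : ∀ t {j i z} → z ≤ suc i →
  CatalanAvoiding (t ∷ʳ j ∷ʳ suc i ∷ʳ z) → j ≡ i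
CatalanAvoiding-descent-pred t {j} {i} {z} z≤1+i ca =
  let (cat , _) , _ , ok = Equivalence.to (CatalanAvoiding-∷ʳ t j (suc i) z) ca
      (_ , 1+i≤1+j)      = Equivalence.to (IsCatalan-∷ʳ t j (suc i)) cat
  in ≤-antisym (m<1+n⇒m≤n (≰⇒> λ 1+i≤j → ok (1+i≤j , z≤1+i))) (≤-pred 1+i≤1+j)

𝟙CA : List ℕ → ℕ
𝟙CA w = 𝟙 (catalanAvoiding? w)

𝟙CA-no : ∀ w → ¬ CatalanAvoiding w → 𝟙CA w ≡ 0
𝟙CA-no w = 𝟙-no (catalanAvoiding? w)

𝟙CA-⇔ : ∀ v w → CatalanAvoiding v ⇔ CatalanAvoiding w → 𝟙CA v ≡ 𝟙CA w
𝟙CA-⇔ v w = 𝟙-⇔ (catalanAvoiding? v) (catalanAvoiding? w)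

ending : ℕ → ℕ → ℕ → ℕ
ending b l z = sumWords b l (λ t → 𝟙CA (t ∷ʳ z))

ending₂ : ℕ → ℕ → ℕ → ℕ → ℕ
ending₂ b l y z = sumWords b l (λ t → 𝟙CA (t ∷ʳ y ∷ʳ z))

ending-∷ʳ : ∀ b l z → ending b (suc l) z ≡ sumUpTo (λ y → ending₂ b l y z) b
ending-∷ʳ b l z = sumWords-∷ʳ b l (λ t → 𝟙CA (t ∷ʳ z))

c≡ending : ∀ b l j → l < b → j < b → c (suc l) j ≡ ending b l j
c≡ending b l j l<b j<b = begin
    c (suc l) j
  ≡⟨ length-filter≡sum-𝟙 P? (words (suc l) (suc l)) ⟩
    sum (map (𝟙 ∘ P?) (words (suc l) (suc l)))
  ≡⟨ sum-map-words (suc l) (suc l) (𝟙 ∘ P?) ⟩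
    sumWords (suc l) (suc l) (𝟙 ∘ P?)
  ≡⟨ sumWords-restrict (suc l) _ l<b outOfRange ⟨
    sumWords b (suc l) (𝟙 ∘ P?)
  ≡⟨ sumWords-∷ʳ b l (𝟙 ∘ P?) ⟩
    sumUpTo (λ x → sumWords b l (λ t → 𝟙 (P? (t ∷ʳ x)))) b
  ≡⟨ sumUpTo-single b j _ j<b otherLast ⟩
    sumWords b l (λ t → 𝟙 (P? (t ∷ʳ j)))
  ≡⟨ sumWords-cong b l (λ t → 𝟙-⇔ (P? (t ∷ʳ j)) (catalanAvoiding? (t ∷ʳ j))
       (mk⇔ proj₁ (_, last-∷ʳ t j))) ⟩
    ending b l j ∎
  where
  P? : (w : List ℕ) → Dec (CatalanAvoiding w × LastIs j w)
  P? w = catalanAvoiding? w ×-dec lastIs? j w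
  outOfRange : ∀ w → length w ≡ suc l → ¬ All (_< suc l) w → 𝟙 (P? w) ≡ 0
  outOfRange w ∣w∣≡1+l ¬w<1+l = 𝟙-no (P? w) λ ((cat , _) , _) →
    ¬w<1+l (subst (λ n → All (_< n) w) ∣w∣≡1+l (IsCatalan-bounded w cat))
  otherLast : ∀ x → x < b → x ≢ j → sumWords b l (λ t → 𝟙 (P? (t ∷ʳ x))) ≡ 0
  otherLast x _ x≢j = sumWords-zero b l λ t _ → 𝟙-no (P? (t ∷ʳ x)) λ (_ , last≡j) →
    x≢j (just-injective (trans (sym (last-∷ʳ t x)) last≡j))

ending-vanish : ∀ b l z → l < z → ending b l z ≡ 0
ending-vanish b l z l<z = sumWords-zero b l λ t ∣t∣≡l → 𝟙CA-no (t ∷ʳ z) λ (cat , _) →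
  <⇒≱ l<z (subst (z ≤_) ∣t∣≡l (IsCatalan-last≤length t z cat))

ending₂-ascent : ∀ b l k → ending₂ b l k (suc k) ≡ ending b l k
ending₂-ascent b l k = sumWords-cong b l λ t →
  𝟙CA-⇔ (t ∷ʳ k ∷ʳ suc k) (t ∷ʳ k) (CatalanAvoiding-ascent t k)

ending₂-jump : ∀ b l {i k} → i < k → ending₂ b l i (suc k) ≡ 0
ending₂-jump b l {i} {k} i<k = sumWords-zero b l λ t _ → 𝟙CA-no (t ∷ʳ i ∷ʳ suc k) λ (cat , _) →
  <⇒≱ i<k (≤-pred (proj₂ (Equivalence.to (IsCatalan-∷ʳ t i (suc k)) cat)))

ending₂-descent : ∀ b l {i z} → i < b → z ≤ suc i → ending₂ b (suc l) (suc i) z ≡ ending b l i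
ending₂-descent b l {i} {z} i<b z≤1+i = begin
    ending₂ b (suc l) (suc i) z
  ≡⟨ sumWords-∷ʳ b l (λ t → 𝟙CA (t ∷ʳ suc i ∷ʳ z)) ⟩
    sumUpTo (λ j → sumWords b l (λ t → 𝟙CA (t ∷ʳ j ∷ʳ suc i ∷ʳ z))) b
  ≡⟨ sumUpTo-single b i _ i<b (λ j _ j≢i → sumWords-zero b l λ t _ →
       𝟙CA-no (t ∷ʳ j ∷ʳ suc i ∷ʳ z) (j≢i ∘ CatalanAvoiding-descent-pred t z≤1+i)) ⟩
    sumWords b l (λ t → 𝟙CA (t ∷ʳ i ∷ʳ suc i ∷ʳ z))
  ≡⟨ sumWords-cong b l (λ t → 𝟙CA-⇔ (t ∷ʳ i ∷ʳ suc i ∷ʳ z) (t ∷ʳ i)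
       (CatalanAvoiding-ascent t i ⇔-∘
        CatalanAvoiding-∷ʳ-after-ascent t z (n<1+n i) (m≤n⇒m≤1+n z≤1+i))) ⟩
    ending b l i ∎

ending₂-zero-zero : ∀ b l → ending₂ b (suc l) 0 0 ≡ 0
ending₂-zero-zero b l = begin
    ending₂ b (suc l) 0 0
  ≡⟨ sumWords-∷ʳ b l (λ t → 𝟙CA (t ∷ʳ 0 ∷ʳ 0)) ⟩
    sumUpTo (λ j → sumWords b l (λ t → 𝟙CA (t ∷ʳ j ∷ʳ 0 ∷ʳ 0))) b
  ≡⟨ sumUpTo-zero b (λ j _ → sumWords-zero b l λ t _ → 𝟙CA-no (t ∷ʳ j ∷ʳ 0 ∷ʳ 0) λ ca →
       proj₂ (proj₂ (Equivalence.to (CatalanAvoiding-∷ʳ t j 0 0) ca)) (z≤n , z≤n)) ⟩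
    0 ∎

ending-tail : ∀ {b} p k → k ≤ suc p → suc p < b →
  sumUpTo (λ i → ending b p (k + i)) (suc (suc p ∸ k)) ≡ sumFrom (c (suc p)) k p
ending-tail {b} p k k≤1+p 1+p<b = begin
    sumUpTo (λ i → ending b p (k + i)) (suc (suc p ∸ k))
  ≡⟨ sumUpTo-trunc _ (n≤1+n _) (λ i e≤i → ending-vanish b p (k + i) (p<k+i e≤i)) ⟩
    sumUpTo (λ i → ending b p (k + i)) (suc p ∸ k)
  ≡⟨ sumUpTo-cong _ (λ i i<e → sym (c≡ending b p (k + i) (<-trans (n<1+n p) 1+p<b) (k+i<b i<e))) ⟩
    sumFrom (c (suc p)) k p ∎
  where
  k+e≡1+p : k + (suc p ∸ k) ≡ suc p
  k+e≡1+p = m+[n∸m]≡n k≤1+p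
  p<k+i : ∀ {i} → suc p ∸ k ≤ i → p < k + i
  p<k+i {i} e≤i = subst (_≤ k + i) k+e≡1+p (+-monoʳ-≤ k e≤i)
  k+i<b : ∀ {i} → i < suc p ∸ k → k + i < b
  k+i<b {i} i<e = <-trans (subst (k + i <_) k+e≡1+p (+-monoʳ-< k i<e)) 1+p<b

c-recurrence-zero : ∀ p → c (3 + p) 0 ≡ sumFrom (c (suc p)) 0 p
c-recurrence-zero p = begin
    c (3 + p) 0
  ≡⟨ c≡ending (3 + p) (2 + p) 0 ≤-refl z<s ⟩
    ending (3 + p) (2 + p) 0
  ≡⟨ ending-∷ʳ (3 + p) (suc p) 0 ⟩
    ending₂ (3 + p) (suc p) 0 0 + sumUpTo (λ i → ending₂ (3 + p) (suc p) (suc i) 0) (2 + p)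
  ≡⟨ cong₂ _+_ (ending₂-zero-zero (3 + p) p)
               (sumUpTo-cong (2 + p) λ i i<2+p → ending₂-descent (3 + p) p (m<n⇒m<1+n i<2+p) z≤n) ⟩
    sumUpTo (ending (3 + p) p) (2 + p)
  ≡⟨ ending-tail p 0 z≤n (n≤1+n _) ⟩
    sumFrom (c (suc p)) 0 p ∎

c-recurrence-suc : ∀ p k → k ≤ suc p → c (3 + p) (suc k) ≡ c (2 + p) k + sumFrom (c (suc p)) k p
c-recurrence-suc p k k≤1+p = begin
    c (3 + p) (suc k)
  ≡⟨ c≡ending (3 + p) (2 + p) (suc k) ≤-refl (s<s k<2+p) ⟩
    ending (3 + p) (2 + p) (suc k)
  ≡⟨ ending-∷ʳ (3 + p) (suc p) (suc k) ⟩
    sumUpTo h (3 + p)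
  ≡⟨ cong (sumUpTo h) k+[1+m]≡3+p ⟨
    sumUpTo h (k + suc m)
  ≡⟨ sumUpTo-split k m h ⟩
    sumUpTo h k + h k + sumUpTo (λ i → h (suc (k + i))) m
  ≡⟨ cong₂ _+_ (cong₂ _+_ (sumUpTo-zero k λ _ → ending₂-jump (3 + p) (suc p)) ascent)
               (sumUpTo-cong m descent) ⟩
    c (2 + p) k + sumUpTo (λ i → ending (3 + p) p (k + i)) m
  ≡⟨ cong (c (2 + p) k +_) (ending-tail p k k≤1+p (n≤1+n _)) ⟩
    c (2 + p) k + sumFrom (c (suc p)) k p ∎
  where
  m : ℕ
  m = suc (suc p ∸ k)
  h : ℕ → ℕ
  h i = ending₂ (3 + p) (suc p) i (suc k)
  k<2+p : k < 2 + p
  k<2+p = s≤s k≤1+p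
  k+[1+m]≡3+p : k + suc m ≡ 3 + p
  k+[1+m]≡3+p = begin
    k + suc (suc (suc p ∸ k))   ≡⟨ +-suc k _ ⟩
    suc (k + suc (suc p ∸ k))   ≡⟨ cong suc (+-suc k _) ⟩
    suc (suc (k + (suc p ∸ k))) ≡⟨ cong (suc ∘ suc) (m+[n∸m]≡n k≤1+p) ⟩
    3 + p                       ∎
  ascent : h k ≡ c (2 + p) k
  ascent = trans (ending₂-ascent (3 + p) (suc p) k)
                 (sym (c≡ending (3 + p) (suc p) k (n≤1+n _) (m<n⇒m<1+n k<2+p)))
  descent : ∀ i → i < m → h (suc (k + i)) ≡ ending (3 + p) p (k + i)
  descent i i<m = ending₂-descent (3 + p) p
    (subst (k + i <_) k+[1+m]≡3+p (+-monoʳ-< k (m<n⇒m<1+n i<m))) (s≤s (m≤m+n k i))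

corollary3p3 :
    (c 1 0 ≡ 1 × c 2 0 ≡ 1 × c 2 1 ≡ 1)
    × ((n k : ℕ) → 2 ≤ n → k < n →
        (c (suc n) 0 ≡ sumFrom (c (n ∸ 1)) 0 (n ∸ 2))
        × (c (suc n) (suc k) ≡ c n k + sumFrom (c (n ∸ 1)) k (n ∸ 2)))
corollary3p3 = (refl , refl , refl) , λ where
  (suc (suc p)) k (s≤s (s≤s z≤n)) (s<s k≤1+p) → c-recurrence-zero p , c-recurrence-suc p k k≤1+p
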